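{- Let $\gamma\ge2$ be an integer. Define the graded set $\mathrm{RC}_\gamma$ by $\mathrm{RC}_\gamma(n)=\mathbf{Mag}(n)$ if $n\le\gamma$ and $\mathrm{RC}_\gamma(n)=\{\mathrm{RComb}_{n-1}\}$ if $n\ge\gamma+1$, with partial compositions: for $\mathfrak{t}_1\in\mathrm{RC}_\gamma(n_1)$, $\mathfrak{t}_2\in\mathrm{RC}_\gamma(n_2)$, $i\in[n_1]$ and $n:=n_1+n_2-1$, $\mathfrak{t}_1\circ_i\mathfrak{t}_2$ is the composition in $\mathbf{Mag}$ if $n\le\gamma$, and $\mathrm{RComb}_{n-1}$ otherwise. Then $\mathrm{RC}_\gamma$ is an operad isomorphic to $\mathbf{Mag}/_{\equiv}$, where $\equiv$ is the smallest operad congruence on $\mathbf{Mag}$ such that $\mathfrak{t}\equiv\mathrm{RComb}_\gamma$ for every binary tree $\mathfrak{t}$ with $\gamma+1$ leaves.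
   Context: Operads are nonsymmetric set-theoretic operads. A binary tree is either the leaf or an ordered pair $(\mathfrak{t}_1,\mathfrak{t}_2)$ of binary trees; its arity is its number of leaves. $\mathbf{Mag}(n)$ is the set of binary trees of arity $n$; the operad $\mathbf{Mag}$ has partial composition $\mathfrak{t}\circ_i\mathfrak{s}$ grafting the root of $\mathfrak{s}$ onto the $i$-th leaf (left to right) of $\mathfrak{t}$, and unit the leaf. The right comb $\mathrm{RComb}_d$ ($d\ge1$) is defined by $\mathrm{RComb}_1=(\text{leaf},\text{leaf})$ and $\mathrm{RComb}_d=(\text{leaf},\mathrm{RComb}_{d-1})$; it has $d$ internal nodes and arity $d+1$. An operad congruence is an arity-preserving equivalence relation $\equiv$ such that $x\equiv x'$, $y\equiv y'$ imply $x\circ_i y\equiv x'\circ_i y'$; $\mathbf{Mag}/_\equiv$ is the quotient operad of equivalence classes. -}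

module Defs where

open import Data.Nat using (ℕ; zero; suc; _+_; _∸_; _≤_; _<_; _≤?_)
open import Data.Product using (Σ; _×_; ∃)
open import Data.Sum using (_⊎_)
open import Relation.Nullary using (yes; no)
open import Relation.Binary.PropositionalEquality using (_≡_)
open import Function.Bundles using (_⇔_)

data Tree : Set where
  leaf : Tree
  node : Tree → Tree → Tree

-- arity = number of leaves; Mag(n) = trees t with arity t ≡ n
arity : Tree → ℕ
arity leaf       = 1
arity (node l r) = arity l + arity r

-- Partial composition of Mag: graft s onto the i-th leaf (1-based, left
-- to right) of t.  (Out-of-range indices return t unchanged; they are never
-- used in the statement.)
graft : Tree → ℕ → Tree → Tree
graft leaf       1 s = s
graft leaf       _ s = leaf
graft (node l r) i s with i ≤? arity l
... | yes _ = node (graft l i s) r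
... | no  _ = node l (graft r (i ∸ arity l) s)

-- Right combs: rcomb d = RComb_d for d ≥ 1 (d internal nodes, arity d+1);
-- rcomb 0 = leaf is a harmless convention.
rcomb : ℕ → Tree
rcomb zero    = leaf
rcomb (suc d) = node leaf (rcomb d)

-- A nonsymmetric set-operad whose elements are binary trees satisfying P,
-- graded by arity, with partial composition c and unit u.  The index i in
-- c x i y is 1-based.
record IsNSOperad (P : Tree → Set) (c : Tree → ℕ → Tree → Tree) (u : Tree) : Set where
  field
    unit-mem   : P u
    unit-arity : arity u ≡ 1
    closed     : ∀ x y i → P x → P y → 1 ≤ i → i ≤ arity x →
                 P (c x i y) × arity (c x i y) ≡ arity x + arity y ∸ 1
    unitˡ      : ∀ x → P x → c u 1 x ≡ x
    unitʳ      : ∀ x i → P x → 1 ≤ i → i ≤ arity x → c x i u ≡ x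
    assoc-seq  : ∀ x y z i j → P x → P y → P z →
                 1 ≤ i → i ≤ arity x → 1 ≤ j → j ≤ arity y →
                 c (c x i y) (i + j ∸ 1) z ≡ c x i (c y j z)
    assoc-par  : ∀ x y z i j → P x → P y → P z →
                 1 ≤ i → i < j → j ≤ arity x →
                 c (c x i y) (j + arity y ∸ 1) z ≡ c (c x j z) i y

InRC : ℕ → Tree → Set
InRC γ t = arity t ≤ γ ⊎ t ≡ rcomb (arity t ∸ 1)

compRC : ℕ → Tree → ℕ → Tree → Tree
compRC γ t i s with arity t + arity s ∸ 1 ≤? γ
... | yes _ = graft t i s
... | no  _ = rcomb (arity t + arity s ∸ 2)

data Cong (γ : ℕ) : Tree → Tree → Set where
  gen   : ∀ t → arity t ≡ suc γ → Cong γ t (rcomb γ)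
  crefl : ∀ t → Cong γ t t
  csym  : ∀ {t t'} → Cong γ t t' → Cong γ t' t
  ctrans : ∀ {t t' t''} → Cong γ t t' → Cong γ t' t'' → Cong γ t t''
  ccomp : ∀ {x x' y y'} i → 1 ≤ i → i ≤ arity x →
          Cong γ x x' → Cong γ y y' → Cong γ (graft x i y) (graft x' i y')

-- Mag/≡ ≅ RC_γ as operads, expressed without quotient types: a map
-- φ : Mag → RC_γ which is an arity-preserving operad morphism, surjective in
-- each arity, and whose kernel is exactly ≡ (so it descends to an operad
-- isomorphism Mag/≡ → RC_γ, and every such isomorphism arises this way).
record QuotientIso (γ : ℕ) (φ : Tree → Tree) : Set where
  field
    φ-mem    : ∀ t → InRC γ (φ t)
    φ-arity  : ∀ t → arity (φ t) ≡ arity t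
    φ-unit   : φ leaf ≡ leaf
    φ-comp   : ∀ t i s → 1 ≤ i → i ≤ arity t →
               φ (graft t i s) ≡ compRC γ (φ t) i (φ s)
    φ-surj   : ∀ u → InRC γ u → Σ Tree (λ t → φ t ≡ u)
    φ-kernel : ∀ t t' → (φ t ≡ φ t') ⇔ Cong γ t t'

-- Collapsing every tree of arity n > γ to RComb_{n-1}, and fixing the smaller ones, is a
-- retraction of Mag onto RC_γ, and compRC γ is grafting followed by collapsing.  On large trees
-- the collapse only remembers the arity, and arities add under grafting, so its kernel is
-- compatible with grafting: the operad laws of Mag descend to RC_γ and the collapse is an
-- operad morphism.  That kernel contains the generators of ≡; conversely every tree of arity
-- n > γ is ≡ RComb_{n-1}, by induction on n: remove a cherry, turn the rest into a comb, and
-- let the comb absorb the cherry again.  This is where γ ≥ 2 is needed: a cherry followed by a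
-- comb with γ - 1 leaves has arity γ + 1, so the generating relation straightens it.
module Submission where

open import Defs
open import Data.Nat using (ℕ; zero; suc; _+_; _∸_; _≤_; _<_; _≤?_; z≤n; s≤s; s≤s⁻¹; _≤′_; ≤′-reflexive; ≤′-refl; ≤′-step)
open import Data.Nat.Properties
open import Data.Product using (Σ; _×_; _,_)
open import Data.Sum using (inj₁; inj₂)
open import Relation.Nullary using (yes; no)
open import Relation.Nullary.Negation using (contradiction)
open import Relation.Binary.PropositionalEquality
open import Function.Bundles using (mk⇔)
open import Algebra.Properties.CommutativeSemigroup +-commutativeSemigroup using (xy∙z≈xz∙y)

1≤arity : ∀ t → 1 ≤ arity t
1≤arity leaf       = ≤-refl
1≤arity (node l r) = ≤-trans (1≤arity l) (m≤m+n (arity l) (arity r))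

graft-node-≤ : ∀ l r {i} s → i ≤ arity l → graft (node l r) i s ≡ node (graft l i s) r
graft-node-≤ l r {i} s i≤ with i ≤? arity l
... | yes _  = refl
... | no  i≰ = contradiction i≤ i≰

graft-node-> : ∀ l r {i} s → arity l < i → graft (node l r) i s ≡ node l (graft r (i ∸ arity l) s)
graft-node-> l r {i} s l<i with i ≤? arity l
... | yes i≤ = contradiction i≤ (<⇒≱ l<i)
... | no  _  = refl

suc-arity-graft : ∀ t {i} s → 1 ≤ i → i ≤ arity t → suc (arity (graft t i s)) ≡ arity t + arity s
suc-arity-graft leaf       s (s≤s z≤n) (s≤s z≤n) = refl
suc-arity-graft (node l r) {i} s 1≤i i≤ with i ≤? arity l
... | yes i≤l = begin
  suc (arity (graft l i s) + arity r) ≡⟨ cong (_+ arity r) (suc-arity-graft l s 1≤i i≤l) ⟩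
  arity l + arity s + arity r         ≡⟨ xy∙z≈xz∙y (arity l) (arity s) (arity r) ⟩
  arity l + arity r + arity s         ∎
  where open ≡-Reasoning
... | no  i≰l = begin
  suc (arity l + arity (graft r (i ∸ arity l) s)) ≡⟨ sym (+-suc (arity l) _) ⟩
  arity l + suc (arity (graft r (i ∸ arity l) s)) ≡⟨ cong (arity l +_) (suc-arity-graft r s (m<n⇒0<n∸m (≰⇒> i≰l)) (m≤n+o⇒m∸n≤o i (arity l) i≤)) ⟩
  arity l + (arity r + arity s)                   ≡⟨ sym (+-assoc (arity l) (arity r) (arity s)) ⟩
  arity l + arity r + arity s                     ∎
  where open ≡-Reasoning

arity-graft : ∀ t {i} s → 1 ≤ i → i ≤ arity t → arity (graft t i s) ≡ arity t + arity s ∸ 1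
arity-graft t s 1≤i i≤ = cong (_∸ 1) (suc-arity-graft t s 1≤i i≤)

≤-arity-graft : ∀ t {i} s {a b} → 1 ≤ i → i ≤ arity t → a ≤ arity t → b ≤ arity s →
                a + b ∸ 1 ≤ arity (graft t i s)
≤-arity-graft t s 1≤i i≤ a≤ b≤ =
  subst (_ ≤_) (sym (arity-graft t s 1≤i i≤)) (∸-monoˡ-≤ 1 (+-mono-≤ a≤ b≤))

arity≤arity-graftˡ : ∀ t {i} s → 1 ≤ i → i ≤ arity t → arity t ≤ arity (graft t i s)
arity≤arity-graftˡ t {i} s 1≤i i≤ =
  subst (_≤ arity (graft t i s)) (m+n∸n≡m (arity t) 1) (≤-arity-graft t s 1≤i i≤ ≤-refl (1≤arity s))

arity≤arity-graftʳ : ∀ t {i} s → 1 ≤ i → i ≤ arity t → arity s ≤ arity (graft t i s)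
arity≤arity-graftʳ t s 1≤i i≤ = ≤-arity-graft t s 1≤i i≤ (1≤arity t) ≤-refl

graft-unitʳ : ∀ t {i} → 1 ≤ i → i ≤ arity t → graft t i leaf ≡ t
graft-unitʳ leaf       (s≤s z≤n) (s≤s z≤n) = refl
graft-unitʳ (node l r) {i} 1≤i i≤ with i ≤? arity l
... | yes i≤l = cong (λ l′ → node l′ r) (graft-unitʳ l 1≤i i≤l)
... | no  i≰l = cong (node l) (graft-unitʳ r (m<n⇒0<n∸m (≰⇒> i≰l)) (m≤n+o⇒m∸n≤o i (arity l) i≤))

m≤m+n∸1 : ∀ m {n} → 1 ≤ n → m ≤ m + n ∸ 1
m≤m+n∸1 m {n} 1≤n = subst (m ≤_) (sym (+-∸-assoc m 1≤n)) (m≤m+n m (n ∸ 1))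

[m+n∸1]∸o≡[m∸o]+n∸1 : ∀ m n {o} → o ≤ m → m + n ∸ 1 ∸ o ≡ m ∸ o + n ∸ 1
[m+n∸1]∸o≡[m∸o]+n∸1 m n {o} o≤m = begin
  m + n ∸ 1 ∸ o   ≡⟨ ∸-+-assoc (m + n) 1 o ⟩
  m + n ∸ suc o   ≡⟨ cong (m + n ∸_) (+-comm 1 o) ⟩
  m + n ∸ (o + 1) ≡⟨ sym (∸-+-assoc (m + n) o 1) ⟩
  m + n ∸ o ∸ 1   ≡⟨ cong (_∸ 1) (+-∸-comm n o≤m) ⟩
  m ∸ o + n ∸ 1   ∎
  where open ≡-Reasoning

[m+o∸1]∸[n+o∸1]≡m∸n : ∀ m n {o} → 1 ≤ o → m + o ∸ 1 ∸ (n + o ∸ 1) ≡ m ∸ n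
[m+o∸1]∸[n+o∸1]≡m∸n m n {o} 1≤o = begin
  m + o ∸ 1 ∸ (n + o ∸ 1)         ≡⟨ cong₂ _∸_ (+-∸-assoc m 1≤o) (+-∸-assoc n 1≤o) ⟩
  m + (o ∸ 1) ∸ (n + (o ∸ 1))     ≡⟨ cong₂ _∸_ (+-comm m (o ∸ 1)) (+-comm n (o ∸ 1)) ⟩
  o ∸ 1 + m ∸ (o ∸ 1 + n)         ≡⟨ [m+n]∸[m+o]≡n∸o (o ∸ 1) m n ⟩
  m ∸ n                           ∎
  where open ≡-Reasoning

graft-assoc-seq : ∀ x y z {i j} → 1 ≤ i → i ≤ arity x → 1 ≤ j → j ≤ arity y →
                  graft (graft x i y) (i + j ∸ 1) z ≡ graft x i (graft y j z)
graft-assoc-seq leaf       y z (s≤s z≤n) (s≤s z≤n) 1≤j j≤ = refl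
graft-assoc-seq (node l r) y z {i} {j} 1≤i i≤ 1≤j j≤ with i ≤? arity l
... | yes i≤l = begin
  graft (node (graft l i y) r) (i + j ∸ 1) z
    ≡⟨ graft-node-≤ (graft l i y) r z (≤-arity-graft l y 1≤i i≤l i≤l j≤) ⟩
  node (graft (graft l i y) (i + j ∸ 1) z) r
    ≡⟨ cong (λ l′ → node l′ r) (graft-assoc-seq l y z 1≤i i≤l 1≤j j≤) ⟩
  node (graft l i (graft y j z)) r
    ∎
  where open ≡-Reasoning
... | no  i≰l = begin
  graft (node l (graft r (i ∸ arity l) y)) (i + j ∸ 1) z
    ≡⟨ graft-node-> l _ z (<-≤-trans l<i (m≤m+n∸1 i 1≤j)) ⟩
  node l (graft (graft r (i ∸ arity l) y) (i + j ∸ 1 ∸ arity l) z)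
    ≡⟨ cong (λ k → node l (graft (graft r (i ∸ arity l) y) k z)) ([m+n∸1]∸o≡[m∸o]+n∸1 i j (<⇒≤ l<i)) ⟩
  node l (graft (graft r (i ∸ arity l) y) (i ∸ arity l + j ∸ 1) z)
    ≡⟨ cong (node l) (graft-assoc-seq r y z (m<n⇒0<n∸m l<i) (m≤n+o⇒m∸n≤o i (arity l) i≤) 1≤j j≤) ⟩
  node l (graft r (i ∸ arity l) (graft y j z))
    ∎
  where
  open ≡-Reasoning
  l<i = ≰⇒> i≰l

graft-assoc-par : ∀ x y z {i j} → 1 ≤ i → i < j → j ≤ arity x →
                  graft (graft x i y) (j + arity y ∸ 1) z ≡ graft (graft x j z) i y
graft-assoc-par leaf       y z (s≤s z≤n) (s≤s (s≤s _)) (s≤s ())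
graft-assoc-par (node l r) y z {i} {j} 1≤i i<j j≤ with i ≤? arity l | j ≤? arity l
... | yes i≤l | yes j≤l = begin
  graft (node (graft l i y) r) (j + arity y ∸ 1) z
    ≡⟨ graft-node-≤ (graft l i y) r z (≤-arity-graft l y 1≤i i≤l j≤l ≤-refl) ⟩
  node (graft (graft l i y) (j + arity y ∸ 1) z) r
    ≡⟨ cong (λ l′ → node l′ r) (graft-assoc-par l y z 1≤i i<j j≤l) ⟩
  node (graft (graft l j z) i y) r
    ≡⟨ graft-node-≤ (graft l j z) r y (≤-trans i≤l (arity≤arity-graftˡ l z 1≤j j≤l)) ⟨
  graft (node (graft l j z) r) i y
    ∎
  where
  open ≡-Reasoning
  1≤j = ≤-trans 1≤i (<⇒≤ i<j)
... | yes i≤l | no j≰l = begin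
  graft (node (graft l i y) r) (j + arity y ∸ 1) z
    ≡⟨ graft-node-> (graft l i y) r z li<k ⟩
  node (graft l i y) (graft r (j + arity y ∸ 1 ∸ arity (graft l i y)) z)
    ≡⟨ cong (λ k → node (graft l i y) (graft r k z)) k∸li≡j∸l ⟩
  node (graft l i y) (graft r (j ∸ arity l) z)
    ≡⟨ graft-node-≤ l (graft r (j ∸ arity l) z) y i≤l ⟨
  graft (node l (graft r (j ∸ arity l) z)) i y
    ∎
  where
  open ≡-Reasoning
  l<j = ≰⇒> j≰l
  li<k : arity (graft l i y) < j + arity y ∸ 1
  li<k = subst (_< j + arity y ∸ 1) (sym (arity-graft l y 1≤i i≤l))
           (∸-monoˡ-< (+-monoˡ-< (arity y) l<j) (≤-trans (1≤arity l) (m≤m+n _ _)))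
  k∸li≡j∸l : j + arity y ∸ 1 ∸ arity (graft l i y) ≡ j ∸ arity l
  k∸li≡j∸l = trans (cong (j + arity y ∸ 1 ∸_) (arity-graft l y 1≤i i≤l))
                ([m+o∸1]∸[n+o∸1]≡m∸n j (arity l) (1≤arity y))
... | no i≰l | yes j≤l = contradiction (≤-trans (<⇒≤ i<j) j≤l) i≰l
... | no i≰l | no j≰l = begin
  graft (node l (graft r (i ∸ arity l) y)) (j + arity y ∸ 1) z
    ≡⟨ graft-node-> l _ z (<-≤-trans l<j (m≤m+n∸1 j (1≤arity y))) ⟩
  node l (graft (graft r (i ∸ arity l) y) (j + arity y ∸ 1 ∸ arity l) z)
    ≡⟨ cong (λ k → node l (graft (graft r (i ∸ arity l) y) k z)) ([m+n∸1]∸o≡[m∸o]+n∸1 j (arity y) (<⇒≤ l<j)) ⟩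
  node l (graft (graft r (i ∸ arity l) y) (j ∸ arity l + arity y ∸ 1) z)
    ≡⟨ cong (node l) (graft-assoc-par r y z (m<n⇒0<n∸m l<i) (∸-monoˡ-< i<j (<⇒≤ l<i)) (m≤n+o⇒m∸n≤o j (arity l) j≤)) ⟩
  node l (graft (graft r (j ∸ arity l) z) (i ∸ arity l) y)
    ≡⟨ graft-node-> l _ y l<i ⟨
  graft (node l (graft r (j ∸ arity l) z)) i y
    ∎
  where
  open ≡-Reasoning
  l<i = ≰⇒> i≰l
  l<j = ≰⇒> j≰l

arity-rcomb : ∀ d → arity (rcomb d) ≡ suc d
arity-rcomb zero    = refl
arity-rcomb (suc d) = cong suc (arity-rcomb d)

graft-rcomb-last : ∀ k d → graft (rcomb k) (suc k) (rcomb d) ≡ rcomb (k + d)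
graft-rcomb-last zero    d = refl
graft-rcomb-last (suc k) d = cong (node leaf) (graft-rcomb-last k d)

module _ (γ : ℕ) where

  collapse : Tree → Tree
  collapse t with arity t ≤? γ
  ... | yes _ = t
  ... | no  _ = rcomb (arity t ∸ 1)

  collapse-small : ∀ t → arity t ≤ γ → collapse t ≡ t
  collapse-small t t≤γ with arity t ≤? γ
  ... | yes _   = refl
  ... | no  t≰γ = contradiction t≤γ t≰γ

  collapse-large : ∀ t → γ < arity t → collapse t ≡ rcomb (arity t ∸ 1)
  collapse-large t γ<t with arity t ≤? γ
  ... | yes t≤γ = contradiction t≤γ (<⇒≱ γ<t)
  ... | no  _   = refl

  arity-collapse : ∀ t → arity (collapse t) ≡ arity t
  arity-collapse t with arity t ≤? γ
  ... | yes _   = refl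
  ... | no  _   = trans (arity-rcomb (arity t ∸ 1)) (m+[n∸m]≡n (1≤arity t))

  collapse-InRC : ∀ t → InRC γ (collapse t)
  collapse-InRC t with arity t ≤? γ
  ... | yes t≤γ = inj₁ t≤γ
  ... | no  _   = inj₂ (cong (λ n → rcomb (n ∸ 1)) (sym (arity-rcomb (arity t ∸ 1))))

  collapse-fixes-InRC : ∀ {u} → InRC γ u → collapse u ≡ u
  collapse-fixes-InRC {u} u∈RC with arity u ≤? γ | u∈RC
  ... | yes _   | _           = refl
  ... | no  u≰γ | inj₁ u≤γ    = contradiction u≤γ u≰γ
  ... | no  _   | inj₂ u≡comb = sym u≡comb

  collapse-idem : ∀ t → collapse (collapse t) ≡ collapse t
  collapse-idem t = collapse-fixes-InRC (collapse-InRC t)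

  collapse-large-arity : ∀ t t′ → γ < arity t → arity t ≡ arity t′ → collapse t ≡ collapse t′
  collapse-large-arity t t′ γ<t t≡t′ = begin
    collapse t              ≡⟨ collapse-large t γ<t ⟩
    rcomb (arity t ∸ 1)     ≡⟨ cong (λ n → rcomb (n ∸ 1)) t≡t′ ⟩
    rcomb (arity t′ ∸ 1)    ≡⟨ collapse-large t′ (subst (γ <_) t≡t′ γ<t) ⟨
    collapse t′             ∎
    where open ≡-Reasoning

  collapse-graft-collapse : ∀ x {i} y → 1 ≤ i → i ≤ arity x →
                            collapse (graft (collapse x) i (collapse y)) ≡ collapse (graft x i y)
  collapse-graft-collapse x {i} y 1≤i i≤ with arity (graft x i y) ≤? γ
  ... | yes g≤γ = begin
    collapse (graft (collapse x) i (collapse y))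
      ≡⟨ cong₂ (λ x′ y′ → collapse (graft x′ i y′)) (collapse-small x (≤-trans x≤g g≤γ)) (collapse-small y (≤-trans y≤g g≤γ)) ⟩
    collapse (graft x i y)
      ≡⟨ collapse-small (graft x i y) g≤γ ⟩
    graft x i y
      ∎
    where
    open ≡-Reasoning
    x≤g = arity≤arity-graftˡ x y 1≤i i≤
    y≤g = arity≤arity-graftʳ x y 1≤i i≤
  ... | no  g≰γ = begin
    collapse (graft (collapse x) i (collapse y))
      ≡⟨ collapse-large (graft (collapse x) i (collapse y)) (subst (γ <_) (sym same-arity) (≰⇒> g≰γ)) ⟩
    rcomb (arity (graft (collapse x) i (collapse y)) ∸ 1)
      ≡⟨ cong (λ n → rcomb (n ∸ 1)) same-arity ⟩
    rcomb (arity (graft x i y) ∸ 1)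
      ∎
    where
    open ≡-Reasoning
    same-arity : arity (graft (collapse x) i (collapse y)) ≡ arity (graft x i y)
    same-arity = begin
      arity (graft (collapse x) i (collapse y))         ≡⟨ arity-graft (collapse x) (collapse y) 1≤i (subst (i ≤_) (sym (arity-collapse x)) i≤) ⟩
      arity (collapse x) + arity (collapse y) ∸ 1       ≡⟨ cong₂ (λ a b → a + b ∸ 1) (arity-collapse x) (arity-collapse y) ⟩
      arity x + arity y ∸ 1                             ≡⟨ arity-graft x y 1≤i i≤ ⟨
      arity (graft x i y)                               ∎

  collapse-graft-cong : ∀ x x′ y y′ {i} → collapse x ≡ collapse x′ → collapse y ≡ collapse y′ →
                        1 ≤ i → i ≤ arity x → collapse (graft x i y) ≡ collapse (graft x′ i y′)
  collapse-graft-cong x x′ y y′ {i} x≈x′ y≈y′ 1≤i i≤ = begin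
    collapse (graft x i y)                              ≡⟨ collapse-graft-collapse x y 1≤i i≤ ⟨
    collapse (graft (collapse x) i (collapse y))        ≡⟨ cong₂ (λ a b → collapse (graft a i b)) x≈x′ y≈y′ ⟩
    collapse (graft (collapse x′) i (collapse y′))      ≡⟨ collapse-graft-collapse x′ y′ 1≤i (subst (i ≤_) x≡x′ i≤) ⟩
    collapse (graft x′ i y′)                            ∎
    where
    open ≡-Reasoning
    x≡x′ : arity x ≡ arity x′
    x≡x′ = trans (sym (arity-collapse x)) (trans (cong arity x≈x′) (arity-collapse x′))

  compRC-collapse : ∀ x {i} y → 1 ≤ i → i ≤ arity x → compRC γ x i y ≡ collapse (graft x i y)
  compRC-collapse x {i} y 1≤i i≤ with arity x + arity y ∸ 1 ≤? γ
  ... | yes s≤γ = sym (collapse-small (graft x i y) (subst (_≤ γ) (sym (arity-graft x y 1≤i i≤)) s≤γ))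
  ... | no  s≰γ = begin
    rcomb (arity x + arity y ∸ 2)        ≡⟨ cong rcomb (∸-+-assoc (arity x + arity y) 1 1) ⟨
    rcomb (arity x + arity y ∸ 1 ∸ 1)    ≡⟨ cong (λ n → rcomb (n ∸ 1)) (arity-graft x y 1≤i i≤) ⟨
    rcomb (arity (graft x i y) ∸ 1)      ≡⟨ collapse-large (graft x i y) (subst (γ <_) (sym (arity-graft x y 1≤i i≤)) (≰⇒> s≰γ)) ⟨
    collapse (graft x i y)               ∎
    where open ≡-Reasoning

  arity-compRC : ∀ x {i} y → 1 ≤ i → i ≤ arity x → arity (compRC γ x i y) ≡ arity (graft x i y)
  arity-compRC x {i} y 1≤i i≤ = trans (cong arity (compRC-collapse x y 1≤i i≤)) (arity-collapse (graft x i y))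

  collapse-graft : ∀ t {i} s → 1 ≤ i → i ≤ arity t →
                   collapse (graft t i s) ≡ compRC γ (collapse t) i (collapse s)
  collapse-graft t {i} s 1≤i i≤ = begin
    collapse (graft t i s)                          ≡⟨ collapse-graft-collapse t s 1≤i i≤ ⟨
    collapse (graft (collapse t) i (collapse s))    ≡⟨ compRC-collapse (collapse t) (collapse s) 1≤i (subst (i ≤_) (sym (arity-collapse t)) i≤) ⟨
    compRC γ (collapse t) i (collapse s)            ∎
    where open ≡-Reasoning

  compRC-nestedˡ : ∀ x {i} y {k} z → 1 ≤ i → i ≤ arity x → 1 ≤ k → k ≤ arity (graft x i y) →
                   compRC γ (compRC γ x i y) k z ≡ collapse (graft (graft x i y) k z)
  compRC-nestedˡ x {i} y {k} z 1≤i i≤ 1≤k k≤ = begin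
    compRC γ (compRC γ x i y) k z                ≡⟨ compRC-collapse (compRC γ x i y) z 1≤k (subst (k ≤_) (sym (arity-compRC x y 1≤i i≤)) k≤) ⟩
    collapse (graft (compRC γ x i y) k z)        ≡⟨ cong (λ w → collapse (graft w k z)) (compRC-collapse x y 1≤i i≤) ⟩
    collapse (graft (collapse (graft x i y)) k z) ≡⟨ collapse-graft-cong (collapse (graft x i y)) (graft x i y) z z (collapse-idem (graft x i y)) refl 1≤k (subst (k ≤_) (sym (arity-collapse (graft x i y))) k≤) ⟩
    collapse (graft (graft x i y) k z)           ∎
    where open ≡-Reasoning

  compRC-nestedʳ : ∀ x {i} y {j} z → 1 ≤ i → i ≤ arity x → 1 ≤ j → j ≤ arity y →
                   compRC γ x i (compRC γ y j z) ≡ collapse (graft x i (graft y j z))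
  compRC-nestedʳ x {i} y {j} z 1≤i i≤ 1≤j j≤ = begin
    compRC γ x i (compRC γ y j z)                ≡⟨ compRC-collapse x (compRC γ y j z) 1≤i i≤ ⟩
    collapse (graft x i (compRC γ y j z))        ≡⟨ cong (λ w → collapse (graft x i w)) (compRC-collapse y z 1≤j j≤) ⟩
    collapse (graft x i (collapse (graft y j z))) ≡⟨ collapse-graft-cong x x (collapse (graft y j z)) (graft y j z) refl (collapse-idem (graft y j z)) 1≤i i≤ ⟩
    collapse (graft x i (graft y j z))           ∎
    where open ≡-Reasoning

  RC-isNSOperad : IsNSOperad (InRC γ) (compRC γ) leaf
  RC-isNSOperad = record
    { unit-mem   = inj₂ refl
    ; unit-arity = refl
    ; closed     = λ x y i _ _ 1≤i i≤ →
        subst (InRC γ) (sym (compRC-collapse x y 1≤i i≤)) (collapse-InRC (graft x i y)) ,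
        trans (arity-compRC x y 1≤i i≤) (arity-graft x y 1≤i i≤)
    ; unitˡ      = λ x x∈RC → trans (compRC-collapse leaf x ≤-refl ≤-refl) (collapse-fixes-InRC x∈RC)
    ; unitʳ      = λ x i x∈RC 1≤i i≤ → begin
        compRC γ x i leaf         ≡⟨ compRC-collapse x leaf 1≤i i≤ ⟩
        collapse (graft x i leaf) ≡⟨ cong collapse (graft-unitʳ x 1≤i i≤) ⟩
        collapse x                ≡⟨ collapse-fixes-InRC x∈RC ⟩
        x                         ∎
    ; assoc-seq  = λ x y z i j _ _ _ 1≤i i≤ 1≤j j≤ → begin
        compRC γ (compRC γ x i y) (i + j ∸ 1) z
          ≡⟨ compRC-nestedˡ x y z 1≤i i≤ (≤-trans 1≤i (m≤m+n∸1 i 1≤j)) (≤-arity-graft x y 1≤i i≤ i≤ j≤) ⟩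
        collapse (graft (graft x i y) (i + j ∸ 1) z)
          ≡⟨ cong collapse (graft-assoc-seq x y z 1≤i i≤ 1≤j j≤) ⟩
        collapse (graft x i (graft y j z))
          ≡⟨ compRC-nestedʳ x y z 1≤i i≤ 1≤j j≤ ⟨
        compRC γ x i (compRC γ y j z)
          ∎
    ; assoc-par  = λ x y z i j _ _ _ 1≤i i<j j≤ →
        let i≤ = ≤-trans (<⇒≤ i<j) j≤
            1≤j = ≤-trans 1≤i (<⇒≤ i<j)
        in begin
        compRC γ (compRC γ x i y) (j + arity y ∸ 1) z
          ≡⟨ compRC-nestedˡ x y z 1≤i i≤ (≤-trans 1≤j (m≤m+n∸1 j (1≤arity y))) (≤-arity-graft x y 1≤i i≤ j≤ ≤-refl) ⟩
        collapse (graft (graft x i y) (j + arity y ∸ 1) z)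
          ≡⟨ cong collapse (graft-assoc-par x y z 1≤i i<j j≤) ⟩
        collapse (graft (graft x j z) i y)
          ≡⟨ compRC-nestedˡ x z y 1≤j j≤ 1≤i (≤-trans i≤ (arity≤arity-graftˡ x z 1≤j j≤)) ⟨
        compRC γ (compRC γ x j z) i y
          ∎
    }
    where open ≡-Reasoning

  collapse-resp-Cong : ∀ {t t′} → Cong γ t t′ → collapse t ≡ collapse t′
  collapse-resp-Cong (gen t t≡1+γ)       =
    collapse-large-arity t (rcomb γ) (subst (γ <_) (sym t≡1+γ) (n<1+n γ)) (trans t≡1+γ (sym (arity-rcomb γ)))
  collapse-resp-Cong (crefl t)           = refl
  collapse-resp-Cong (csym c)            = sym (collapse-resp-Cong c)
  collapse-resp-Cong (ctrans c c′)       = trans (collapse-resp-Cong c) (collapse-resp-Cong c′)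
  collapse-resp-Cong (ccomp {x} {x′} {y} {y′} i 1≤i i≤ c d) =
    collapse-graft-cong x x′ y y′ (collapse-resp-Cong c) (collapse-resp-Cong d) 1≤i i≤

cong-graftˡ : ∀ {γ x x′} y {i} → 1 ≤ i → i ≤ arity x → Cong γ x x′ → Cong γ (graft x i y) (graft x′ i y)
cong-graftˡ y 1≤i i≤ x≈x′ = ccomp _ 1≤i i≤ x≈x′ (crefl y)

cherry : Tree
cherry = node leaf leaf

arity-graft-cherry : ∀ t {i} → 1 ≤ i → i ≤ arity t → arity (graft t i cherry) ≡ suc (arity t)
arity-graft-cherry t 1≤i i≤ = suc-injective (trans (suc-arity-graft t cherry 1≤i i≤) (+-comm (arity t) 2))

record CherryDecomposition (t : Tree) : Set where
  constructor decomposition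
  field
    pruned       : Tree
    position     : ℕ
    1≤position   : 1 ≤ position
    position≤    : position ≤ arity pruned
    graft-cherry : graft pruned position cherry ≡ t

cherry-decomposition : ∀ l r → CherryDecomposition (node l r)
cherry-decomposition leaf leaf = decomposition leaf 1 ≤-refl ≤-refl refl
cherry-decomposition (node a b) r with cherry-decomposition a b
... | decomposition t i 1≤i i≤ t∘cherry≡ =
  decomposition (node t r) i 1≤i (≤-trans i≤ (m≤m+n (arity t) (arity r)))
    (trans (graft-node-≤ t r cherry i≤) (cong (λ l → node l r) t∘cherry≡))
cherry-decomposition leaf (node a b) with cherry-decomposition a b
... | decomposition t zero    () _ _
... | decomposition t (suc i) _ i≤ t∘cherry≡ =
  decomposition (node leaf t) (suc (suc i)) (s≤s z≤n) (s≤s i≤) (cong (node leaf) t∘cherry≡)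

module _ (g : ℕ) where

  private
    γ : ℕ
    γ = 2 + g

  cherry-head-absorbed : ∀ {m} → g ≤ m → Cong γ (node cherry (rcomb m)) (rcomb (2 + m))
  cherry-head-absorbed g≤m with m≤n⇒∃[o]m+o≡n g≤m
  ... | d , refl =
    subst₂ (Cong γ) (cong (node cherry) (graft-rcomb-last g d)) (graft-rcomb-last γ d)
      (cong-graftˡ (rcomb d) (s≤s z≤n) (≤-reflexive (sym (cong (2 +_) (arity-rcomb g))))
         (gen (node cherry (rcomb g)) (cong (2 +_) (arity-rcomb g))))

  cherry-absorbed : ∀ {m} → γ ≤′ suc m → ∀ i → 1 ≤ i → i ≤ suc m →
                    Cong γ (graft (rcomb m) i cherry) (rcomb (suc m))
  cherry-absorbed {m} ≤′-refl i 1≤i i≤ =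
    gen _ (trans (arity-graft-cherry (rcomb m) 1≤i (subst (i ≤_) (sym (arity-rcomb m)) i≤))
                 (cong suc (arity-rcomb m)))
  cherry-absorbed {zero}  (≤′-step (≤′-reflexive ())) _ _ _
  cherry-absorbed {suc m} (≤′-step _) zero () _
  cherry-absorbed {suc m} (≤′-step γ≤′1+m) (suc zero) _ _ =
    cherry-head-absorbed (<⇒≤ (s≤s⁻¹ (≤′⇒≤ γ≤′1+m)))
  cherry-absorbed {suc m} (≤′-step γ≤′1+m) (suc (suc i)) _ (s≤s i≤) =
    -- graft cherry 2 u reduces to node leaf u
    ccomp {x = cherry} 2 (s≤s z≤n) ≤-refl (crefl cherry) (cherry-absorbed γ≤′1+m (suc i) (s≤s z≤n) i≤)

  Cong-rcomb : ∀ {n} → γ ≤′ n → ∀ t → arity t ≡ suc n → Cong γ t (rcomb n)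
  Cong-rcomb ≤′-refl             t          t≡ = gen t t≡
  Cong-rcomb (≤′-step γ≤′n)      leaf       ()
  Cong-rcomb (≤′-step {n} γ≤′n) (node l r) t≡ with cherry-decomposition l r
  ... | decomposition t i 1≤i i≤ t∘cherry≡ =
    subst (λ u → Cong γ u (rcomb (suc n))) t∘cherry≡
      (ctrans (cong-graftˡ cherry 1≤i i≤ (Cong-rcomb γ≤′n t t′≡))
              (cherry-absorbed (≤′-step γ≤′n) i 1≤i (subst (i ≤_) t′≡ i≤)))
    where
    t′≡ : arity t ≡ suc n
    t′≡ = suc-injective (trans (sym (arity-graft-cherry t 1≤i i≤)) (trans (cong arity t∘cherry≡) t≡))

  Cong-collapse : ∀ t → Cong γ t (collapse γ t)
  Cong-collapse t with arity t ≤? γ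
  ... | yes _   = crefl t
  ... | no  t≰γ = Cong-rcomb (≤⇒≤′ (∸-monoˡ-≤ 1 (≰⇒> t≰γ))) t (sym (m+[n∸m]≡n (1≤arity t)))

  collapse-quotientIso : QuotientIso γ (collapse γ)
  collapse-quotientIso = record
    { φ-mem    = collapse-InRC γ
    ; φ-arity  = arity-collapse γ
    ; φ-unit   = collapse-fixes-InRC γ (inj₂ refl)
    ; φ-comp   = λ t i s → collapse-graft γ t s
    ; φ-surj   = λ u u∈RC → u , collapse-fixes-InRC γ u∈RC
    ; φ-kernel = λ t t′ → mk⇔
        (λ t≈t′ → ctrans (Cong-collapse t) (subst (λ u → Cong γ u t′) (sym t≈t′) (csym (Cong-collapse t′))))
        (collapse-resp-Cong γ)
    }

lemma2p2p2 : (γ : ℕ) → 2 ≤ γ →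
    IsNSOperad (InRC γ) (compRC γ) leaf × Σ (Tree → Tree) (QuotientIso γ)
lemma2p2p2 zero          ()
lemma2p2p2 (suc zero)    (s≤s ())
lemma2p2p2 (suc (suc g)) _ = RC-isNSOperad (2 + g) , collapse (2 + g) , collapse-quotientIso g
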